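{- Let $G=(V=[n],E)$ be a $d$-regular graph with normalized random walk operator $A_G$. Then for every $k_1,k_2\in\mathbb N^+$, there are representations of $\mathsf S_{k_1,k_2}$ and $A_G$ as matrices (i.e., orderings of their rows and columns) such that $$\mathsf S_{k_1,k_2}=A_G\otimes J/d^{k_2-1},$$ where $J\in\mathbb R^{[d]^{k_1-1}\times[d]^{k_2-1}}$ is the all-ones matrix.
   Context: $W_G(k)$ is the set of walks $w=(w_1,\dots,w_k)$ in $G$ with $k$ vertices, with distribution $\Pi_k$ obtained by choosing $w_1$ from the stationary distribution and taking $k-1$ random walk steps. For $k=k_1+k_2$, the walk Swap operator $\mathsf S_{k_1,k_2}:\mathbb R^{W_G(k_2)}\to\mathbb R^{W_G(k_1)}$ is the matrix with entries $(\mathsf S_{k_1,k_2})_{w,w'}=\Pi_k(ww')/\Pi_{k_1}(w)$ for $w\in W_G(k_1)$, $w'\in W_G(k_2)$, where $ww'$ is the concatenation (and $\Pi_k(ww')=0$ if $ww'$ is not a walk); equivalently $(\mathsf S_{k_1,k_2}f)(w)=\mathbb E_{w':ww'\in W_G(k)}[f(w')]$. -}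

module Defs where

open import Data.Nat as ℕ using (ℕ; zero; suc; _∸_; NonZero)
open import Data.Bool using (Bool; true; false; if_then_else_)
open import Data.Fin using (Fin)
open import Data.List using (List; map; allFin)
open import Data.Nat.ListAction using (sum)
open import Data.Vec using (Vec; []; _∷_; _++_)
open import Data.Product using (Σ; _×_; _,_; proj₁; proj₂)
open import Data.Unit using (⊤)
open import Data.Integer using (ℤ; +_)
open import Data.Rational using (ℚ; 0ℚ; 1ℚ; _*_; _/_; _÷_; _≟_; ≢-nonZero)
open import Relation.Binary.PropositionalEquality using (_≡_)
open import Relation.Nullary using (yes; no)

record RegularGraph (n d : ℕ) : Set where
  field
    adj       : Fin n → Fin n → Bool
    symmetric : ∀ i j → adj i j ≡ adj j i
    loopless  : ∀ i → adj i i ≡ false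
    regular   : ∀ i → sum (map (λ j → if adj i j then 1 else 0) (allFin n)) ≡ d

module _ {n d : ℕ} .{{_ : NonZero n}} .{{_ : NonZero d}} (G : RegularGraph n d) where
  open RegularGraph G

  A : Fin n → Fin n → ℚ
  A i j = if adj i j then (+ 1) / d else 0ℚ

  IsWalk : ∀ {k} → Vec (Fin n) k → Set
  IsWalk []            = ⊤
  IsWalk (x ∷ [])      = ⊤
  IsWalk (x ∷ y ∷ w)   = (adj x y ≡ true) × IsWalk (y ∷ w)

  W : ℕ → Set
  W k = Σ (Vec (Fin n) k) IsWalk

  steps : ∀ {k} → Vec (Fin n) k → ℚ
  steps []          = 1ℚ
  steps (x ∷ [])    = 1ℚ
  steps (x ∷ y ∷ w) = A x y * steps (y ∷ w)

  -- Π_k : start from the stationary (uniform, G being regular) distribution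
  -- and take k-1 random walk steps.  (Zero on non-walks.)
  Π : ∀ {k} → Vec (Fin n) k → ℚ
  Π w = ((+ 1) / n) * steps w

  -- division, with the (irrelevant) convention p/0 = 0
  _÷₀_ : ℚ → ℚ → ℚ
  p ÷₀ q with q ≟ 0ℚ
  ... | yes _ = 0ℚ
  ... | no q≢0 = _÷_ p q {{≢-nonZero q≢0}}

  Swap : (k₁ k₂ : ℕ) → W k₁ → W k₂ → ℚ
  Swap k₁ k₂ (w , _) (w' , _) = Π (w ++ w') ÷₀ Π w

_⊗_ : {R C R' C' : Set} → (R → C → ℚ) → (R' → C' → ℚ) → (R × R' → C × C' → ℚ)
(M ⊗ N) (i , a) (j , b) = M i j * N a b

_^ℚ_ : ℚ → ℕ → ℚ
p ^ℚ zero  = 1ℚ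
p ^ℚ suc m = p * (p ^ℚ m)

Jscaled : (d r c m : ℕ) .{{_ : NonZero d}} → Vec (Fin d) r → Vec (Fin d) c → ℚ
Jscaled d r c m _ _ = ((+ 1) / d) ^ℚ m

-- Choosing, for each vertex, a bijection between its d neighbours and Fin d, a walk
-- with k vertices is coded by one endpoint together with the k − 1 neighbour choices
-- made when walking from that endpoint.  Code the walks of length k₁ from their last
-- vertex and those of length k₂ from their first.  Every walk has probability
-- (1/n)(1/d)^(#steps), so for a walk w and a walk w' starting at y,
-- Π(ww') = Π(w) · A(last w, y) · (1/d)^(k₂−1), and the Swap entry is
-- A(last w, y) · (1/d)^(k₂−1), which depends on w and w' only through these two vertices.
module Submission where

open import Defs
open import Data.Nat using (ℕ; _≤_; _∸_; NonZero; zero; suc; s≤s; z≤n)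
open import Data.Fin using (Fin; zero; suc)
open import Data.Fin.Properties using (+↔⊎)
open import Data.Vec using (Vec; []; _∷_; _++_; head; last)
open import Data.Product using (Σ; _×_; _,_; proj₁)
open import Data.Product.Function.Dependent.Propositional using (Σ-↔)
open import Data.Sum using (_⊎_; inj₁; inj₂)
open import Data.Sum.Function.Propositional using (_⊎-↔_)
open import Data.Bool using (Bool; true; false; if_then_else_)
import Data.Bool.Properties as Bool
open import Data.Unit using (tt)
open import Data.List using (tabulate)
open import Data.List.Properties using (map-tabulate)
open import Data.Nat.ListAction using (sum)
open import Data.Integer using (+_)
open import Data.Rational using (ℚ; 0ℚ; _*_; _/_; _≟_; Positive)
open import Data.Rational.Properties
  using (*-assoc; *-comm; *-identityˡ; *-identityʳ; *-inverseʳ; pos*pos⇒pos; normalize-pos; positive⁻¹; pos⇒nonZero; <⇒≢)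
open import Function using (_∘_)
open import Function.Bundles using (_↔_; Inverse; mk↔ₛ′)
open import Function.Construct.Composition using (_↔-∘_)
open import Function.Construct.Symmetry using (↔-sym)
open import Function.Construct.Identity using (↔-id)
open import Axiom.UniquenessOfIdentityProofs using (module Decidable⇒UIP)
open import Relation.Binary.PropositionalEquality
  using (_≡_; _≢_; refl; sym; trans; cong; cong₂; subst; ≢-sym; module ≡-Reasoning)
open import Relation.Nullary using (yes; no)
open import Data.Empty using (⊥-elim)

open Inverse using (to)

≡true-irrelevant : {b : Bool} (p q : b ≡ true) → p ≡ q
≡true-irrelevant = Decidable⇒UIP.≡-irrelevant Bool._≟_

indicator : Bool → ℕ
indicator b = if b then 1 else 0

≡true↔Fin-indicator : (b : Bool) → (b ≡ true) ↔ Fin (indicator b)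
≡true↔Fin-indicator true  = mk↔ₛ′ (λ _ → zero) (λ _ → refl) (λ { zero → refl }) (λ { refl → refl })
≡true↔Fin-indicator false = mk↔ₛ′ (λ ()) (λ ()) (λ ()) (λ ())

Σ-Fin-suc↔⊎ : ∀ {m} (P : Fin (suc m) → Set) → Σ (Fin (suc m)) P ↔ (P zero ⊎ Σ (Fin m) (P ∘ suc))
Σ-Fin-suc↔⊎ P = mk↔ₛ′ split join split∘join join∘split
  where
  split : Σ _ P → _
  split (zero  , p) = inj₁ p
  split (suc i , p) = inj₂ (i , p)
  join : _ → Σ _ P
  join (inj₁ p)       = zero , p
  join (inj₂ (i , p)) = suc i , p
  split∘join : ∀ x → split (join x) ≡ x
  split∘join (inj₁ _) = refl
  split∘join (inj₂ _) = refl
  join∘split : ∀ x → join (split x) ≡ x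
  join∘split (zero  , _) = refl
  join∘split (suc _ , _) = refl

countTrue : ∀ {m} → (Fin m → Bool) → ℕ
countTrue f = sum (tabulate (indicator ∘ f))

Σ-≡true↔Fin-countTrue : ∀ {m} (f : Fin m → Bool) → Σ (Fin m) (λ j → f j ≡ true) ↔ Fin (countTrue f)
Σ-≡true↔Fin-countTrue {zero}  f = mk↔ₛ′ (λ { (() , _) }) (λ ()) (λ ()) (λ { (() , _) })
Σ-≡true↔Fin-countTrue {suc m} f =
  ↔-sym +↔⊎ ↔-∘ ((≡true↔Fin-indicator (f zero) ⊎-↔ Σ-≡true↔Fin-countTrue (f ∘ suc)) ↔-∘ Σ-Fin-suc↔⊎ _)

×↔Vec-suc : ∀ {A : Set} {m} → (A × Vec A m) ↔ Vec A (suc m)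
×↔Vec-suc = mk↔ₛ′ (λ { (x , v) → x ∷ v }) (λ { (x ∷ v) → x , v }) (λ { (_ ∷ _) → refl }) (λ { (_ , _) → refl })

^ℚ-pos : ∀ p .{{_ : Positive p}} m → Positive (p ^ℚ m)
^ℚ-pos p zero    = _
^ℚ-pos p (suc m) = pos*pos⇒pos p (p ^ℚ m) {{^ℚ-pos p m}}

pos⇒≢0 : ∀ p .{{_ : Positive p}} → p ≢ 0ℚ
pos⇒≢0 p = ≢-sym (<⇒≢ (positive⁻¹ p))

module _ {n d : ℕ} .{{_ : NonZero n}} .{{_ : NonZero d}} (G : RegularGraph n d) where
  open RegularGraph G

  Neighbour : Fin n → Set
  Neighbour i = Σ (Fin n) (λ j → adj i j ≡ true)

  Neighbour↔Fin : ∀ i → Neighbour i ↔ Fin d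
  Neighbour↔Fin i = subst (λ k → Neighbour i ↔ Fin k) countTrue≡d (Σ-≡true↔Fin-countTrue (adj i))
    where
    countTrue≡d : countTrue (adj i) ≡ d
    countTrue≡d = trans (sym (cong sum (map-tabulate (λ j → j) (indicator ∘ adj i)))) (regular i)

  WalkFrom : Fin n → ℕ → Set
  WalkFrom i m = Σ (Vec (Fin n) m) (λ v → IsWalk G (i ∷ v))

  WalkFrom-suc↔Σ-Neighbour : ∀ {i m} → WalkFrom i (suc m) ↔ Σ (Neighbour i) (λ j → WalkFrom (proj₁ j) m)
  WalkFrom-suc↔Σ-Neighbour = mk↔ₛ′ (λ { (j ∷ v , (p , q)) → (j , p) , (v , q) })
                                  (λ { ((j , p) , (v , q)) → (j ∷ v , (p , q)) })
                                  (λ _ → refl) (λ { (_ ∷ _ , _) → refl })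

  WalkFrom↔choices : ∀ m i → WalkFrom i m ↔ Vec (Fin d) m
  WalkFrom↔choices zero    i = mk↔ₛ′ (λ _ → []) (λ _ → [] , tt) (λ { [] → refl }) (λ { ([] , tt) → refl })
  WalkFrom↔choices (suc m) i =
    ×↔Vec-suc ↔-∘ (Σ-↔ (Neighbour↔Fin i) (λ {j} → WalkFrom↔choices m (proj₁ j)) ↔-∘ WalkFrom-suc↔Σ-Neighbour)

  W↔head-choices : ∀ m → W G (suc m) ↔ (Fin n × Vec (Fin d) m)
  W↔head-choices m = Σ-↔ (↔-id _) (λ {i} → WalkFrom↔choices m i) ↔-∘ uncons
    where
    uncons : W G (suc m) ↔ Σ (Fin n) (λ i → WalkFrom i m)
    uncons = mk↔ₛ′ (λ { (i ∷ v , p) → i , v , p }) (λ { (i , v , p) → i ∷ v , p })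
                   (λ _ → refl) (λ { (_ ∷ _ , _) → refl })

  proj₁-W↔head-choices : ∀ m (w : W G (suc m)) → proj₁ (to (W↔head-choices m) w) ≡ head (proj₁ w)
  proj₁-W↔head-choices m (_ ∷ _ , _) = refl

  -- Symmetry of adj makes the removed first vertex a neighbour of the new head.
  W-suc↔Σ-Neighbour-head : ∀ {m} → W G (suc (suc m)) ↔ Σ (W G (suc m)) (Neighbour ∘ head ∘ proj₁)
  W-suc↔Σ-Neighbour-head = mk↔ₛ′
    (λ { (x ∷ y ∷ v , (p , q)) → (y ∷ v , q) , (x , trans (symmetric y x) p) })
    (λ { ((y ∷ v , q) , (x , p)) → (x ∷ y ∷ v , (trans (symmetric x y) p , q)) })
    (λ { ((y ∷ v , q) , (x , _)) → cong (λ r → (y ∷ v , q) , (x , r)) (≡true-irrelevant _ _) })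
    (λ { (x ∷ y ∷ v , (_ , q)) → cong (λ r → (x ∷ y ∷ v , (r , q))) (≡true-irrelevant _ _) })

  W↔last-choices : ∀ m → W G (suc m) ↔ (Fin n × Vec (Fin d) m)
  W↔last-choices zero = mk↔ₛ′ (λ { (i ∷ [] , _) → i , [] }) (λ { (i , []) → i ∷ [] , tt })
                              (λ { (_ , []) → refl }) (λ { (_ ∷ [] , _) → refl })
  W↔last-choices (suc m) =
    snoc ↔-∘ (Σ-↔ (W↔last-choices m) (λ {w} → Neighbour↔Fin (head (proj₁ w))) ↔-∘ W-suc↔Σ-Neighbour-head)
    where
    snoc : ((Fin n × Vec (Fin d) m) × Fin d) ↔ (Fin n × Vec (Fin d) (suc m))
    snoc = mk↔ₛ′ (λ { ((i , v) , x) → i , x ∷ v }) (λ { (i , x ∷ v) → (i , v) , x })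
                 (λ { (_ , _ ∷ _) → refl }) (λ { ((_ , _) , _) → refl })

  proj₁-W↔last-choices : ∀ m (w : W G (suc m)) → proj₁ (to (W↔last-choices m) w) ≡ last (proj₁ w)
  proj₁-W↔last-choices zero    (_ ∷ [] , _)          = refl
  proj₁-W↔last-choices (suc m) (_ ∷ y ∷ v , (_ , q)) = proj₁-W↔last-choices m (y ∷ v , q)

  transitionProb : ℚ
  transitionProb = (+ 1) / d

  steps-++ : ∀ {m k} (xs : Vec (Fin n) (suc m)) y (u : Vec (Fin n) k) →
             steps G (xs ++ y ∷ u) ≡ steps G xs * (A G (last xs) y * steps G (y ∷ u))
  steps-++ (x ∷ [])     y u = sym (*-identityˡ _)
  steps-++ (x ∷ z ∷ xs) y u = begin
    A G x z * steps G (z ∷ xs ++ y ∷ u)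
      ≡⟨ cong (A G x z *_) (steps-++ (z ∷ xs) y u) ⟩
    A G x z * (steps G (z ∷ xs) * (A G (last (z ∷ xs)) y * steps G (y ∷ u)))
      ≡⟨ *-assoc (A G x z) (steps G (z ∷ xs)) _ ⟨
    A G x z * steps G (z ∷ xs) * (A G (last (z ∷ xs)) y * steps G (y ∷ u))
      ∎
    where open ≡-Reasoning

  steps-walk : ∀ {m} (xs : Vec (Fin n) (suc m)) → IsWalk G xs → steps G xs ≡ transitionProb ^ℚ m
  steps-walk (x ∷ [])     _       = refl
  steps-walk (x ∷ z ∷ xs) (p , q) = cong₂ _*_ (cong (λ b → if b then transitionProb else 0ℚ) p) (steps-walk (z ∷ xs) q)

  Π-walk-pos : ∀ {m} (xs : Vec (Fin n) (suc m)) → IsWalk G xs → Positive (Π G xs)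
  Π-walk-pos {m} xs walk rewrite steps-walk xs walk =
    pos*pos⇒pos ((+ 1) / n) {{normalize-pos 1 n}} (transitionProb ^ℚ m) {{^ℚ-pos transitionProb {{normalize-pos 1 d}} m}}

  Π-++ : ∀ {m k} (xs : Vec (Fin n) (suc m)) y (u : Vec (Fin n) k) → IsWalk G (y ∷ u) →
         Π G (xs ++ y ∷ u) ≡ Π G xs * (A G (last xs) y * transitionProb ^ℚ k)
  Π-++ {k = k} xs y u walk = begin
    (+ 1) / n * steps G (xs ++ y ∷ u)
      ≡⟨ cong ((+ 1) / n *_) (steps-++ xs y u) ⟩
    (+ 1) / n * (steps G xs * (A G (last xs) y * steps G (y ∷ u)))
      ≡⟨ *-assoc ((+ 1) / n) (steps G xs) _ ⟨
    Π G xs * (A G (last xs) y * steps G (y ∷ u))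
      ≡⟨ cong (λ s → Π G xs * (A G (last xs) y * s)) (steps-walk (y ∷ u) walk) ⟩
    Π G xs * (A G (last xs) y * transitionProb ^ℚ k)
      ∎
    where open ≡-Reasoning

  *-÷₀-cancelˡ : ∀ q r .{{_ : Positive q}} → _÷₀_ G (q * r) q ≡ r
  *-÷₀-cancelˡ q r with q ≟ 0ℚ
  ... | yes q≡0 = ⊥-elim (pos⇒≢0 q q≡0)
  ... | no _ = begin
    q * r * _    ≡⟨ cong (_* _) (*-comm q r) ⟩
    r * q * _    ≡⟨ *-assoc r q _ ⟩
    r * (q * _)  ≡⟨ cong (r *_) (*-inverseʳ q {{pos⇒nonZero q}}) ⟩
    r * _        ≡⟨ *-identityʳ r ⟩
    r            ∎
    where open ≡-Reasoning

lemma9p16 : {n d : ℕ} .{{_ : NonZero n}} .{{_ : NonZero d}} (G : RegularGraph n d)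
    → (k₁ k₂ : ℕ) → 1 ≤ k₁ → 1 ≤ k₂
    → Σ (W G k₁ ↔ (Fin n × Vec (Fin d) (k₁ ∸ 1))) λ σ₁ →
      Σ (W G k₂ ↔ (Fin n × Vec (Fin d) (k₂ ∸ 1))) λ σ₂ →
        ∀ (w : W G k₁) (w' : W G k₂) →
          Swap G k₁ k₂ w w'
            ≡ (A G ⊗ Jscaled d (k₁ ∸ 1) (k₂ ∸ 1) (k₂ ∸ 1)) (Inverse.to σ₁ w) (Inverse.to σ₂ w')
lemma9p16 G (suc m₁) (suc m₂) (s≤s z≤n) (s≤s z≤n) = W↔last-choices G m₁ , W↔head-choices G m₂ , Swap≡
  where
  Swap≡ : ∀ w w' → Swap G (suc m₁) (suc m₂) w w'
                 ≡ A G (proj₁ (to (W↔last-choices G m₁) w)) (proj₁ (to (W↔head-choices G m₂) w'))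
                     * transitionProb G ^ℚ m₂
  Swap≡ w@(xs , walk) w'@(y ∷ u , walk') = begin
    _÷₀_ G (Π G (xs ++ y ∷ u)) (Π G xs)
      ≡⟨ cong (λ p → _÷₀_ G p (Π G xs)) (Π-++ G xs y u walk') ⟩
    _÷₀_ G (Π G xs * (A G (last xs) y * transitionProb G ^ℚ m₂)) (Π G xs)
      ≡⟨ *-÷₀-cancelˡ G (Π G xs) _ {{Π-walk-pos G xs walk}} ⟩
    A G (last xs) y * transitionProb G ^ℚ m₂
      ≡⟨ cong₂ (λ i j → A G i j * transitionProb G ^ℚ m₂)
               (proj₁-W↔last-choices G m₁ w) (proj₁-W↔head-choices G m₂ w') ⟨
    A G (proj₁ (to (W↔last-choices G m₁) w)) (proj₁ (to (W↔head-choices G m₂) w')) * transitionProb G ^ℚ m₂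
      ∎
    where open ≡-Reasoning
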